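{- Let $n\ge 4$ and let $\tilde{D}_n$ be the graph on the vertices $1,2,\ldots,n+1$ with edge set $\{1,3\},\{2,3\},\{n-1,n\},\{n-1,n+1\}$ and $\{i,i+1\}$ for $3\le i\le n-2$, with adjacency matrix $A$ and walk matrix $W(\tilde{D}_n)=\begin{bmatrix} e_{n+1} & Ae_{n+1} & \cdots & A^{n}e_{n+1}\end{bmatrix}$, where $e_{n+1}$ is the all-ones vector. Let $\hat{W}(\tilde{D}_n)$ be the $(n-1)\times(n-1)$ matrix obtained from $W(\tilde{D}_n)$ by deleting its first and last rows and its last two columns, and let $W'(\tilde{D}_n)$ be the $(n+1)\times(n+1)$ integer matrix whose first row, last row, and last two columns are zero, and whose submatrix in rows $2,\ldots,n$ and columns $1,\ldots,n-1$ equals $\hat{W}(\tilde{D}_n)$. Then $W(\tilde{D}_n)$ and $W'(\tilde{D}_n)$ have the same Smith normal form (i.e., they are integrally equivalent).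
   Context: The Smith normal form of an integer $m\times m$ matrix $M$ of rank $r$ is the diagonal matrix $\operatorname{diag}(d_1,\ldots,d_r,0,\ldots,0)$ with positive integers $d_i$ and $d_i\mid d_{i+1}$, obtained from $M$ by multiplying on the left and right by unimodular integer matrices; two integer matrices have the same Smith normal form iff they are integrally equivalent. -}

module Defs where

open import Data.Nat as ℕ using (ℕ; zero; suc; _∸_; _≡ᵇ_; _≤ᵇ_)
open import Data.Bool using (Bool; true; false; _∧_; _∨_; if_then_else_)
open import Data.Fin using (Fin; toℕ)
import Data.Fin as Fin
open import Data.Integer using (ℤ; 0ℤ; 1ℤ; _+_; _*_)
open import Data.Product using (Σ; _×_; ∃)
open import Relation.Binary.PropositionalEquality using (_≡_)

Matrix : ℕ → Set
Matrix m = Fin m → Fin m → ℤ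

Vector : ℕ → Set
Vector m = Fin m → ℤ

∑ : ∀ {k} → (Fin k → ℤ) → ℤ
∑ {zero}  f = 0ℤ
∑ {suc k} f = f Fin.zero + ∑ (λ i → f (Fin.suc i))

_⊗_ : ∀ {m} → Matrix m → Matrix m → Matrix m
(M ⊗ N) i j = ∑ (λ k → M i k * N k j)

_·_ : ∀ {m} → Matrix m → Vector m → Vector m
(M · v) i = ∑ (λ k → M i k * v k)

identity : ∀ {m} → Matrix m
identity i j = if toℕ i ≡ᵇ toℕ j then 1ℤ else 0ℤ

_≋_ : ∀ {m} → Matrix m → Matrix m → Set
M ≋ N = ∀ i j → M i j ≡ N i j

Unimodular : ∀ {m} → Matrix m → Set
Unimodular {m} P = Σ (Matrix m) λ Q → ((P ⊗ Q) ≋ identity) × ((Q ⊗ P) ≋ identity)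

IntegrallyEquivalent : ∀ {m} → Matrix m → Matrix m → Set
IntegrallyEquivalent {m} M N =
  Σ (Matrix m) λ P → Σ (Matrix m) λ Q →
    Unimodular P × Unimodular Q × (((P ⊗ M) ⊗ Q) ≋ N)

Dedgeᵇ : ℕ → ℕ → ℕ → Bool
Dedgeᵇ n a b =
     ((a ≡ᵇ 1) ∧ (b ≡ᵇ 3))
  ∨ ((a ≡ᵇ 2) ∧ (b ≡ᵇ 3))
  ∨ ((a ≡ᵇ (n ∸ 1)) ∧ (b ≡ᵇ n))
  ∨ ((a ≡ᵇ (n ∸ 1)) ∧ (b ≡ᵇ suc n))
  ∨ ((3 ≤ᵇ a) ∧ (a ≤ᵇ (n ∸ 2)) ∧ (b ≡ᵇ suc a))

-- Adjacency matrix of D̃_n; index i : Fin (n+1) is vertex (toℕ i + 1).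
adjD : (n : ℕ) → Matrix (suc n)
adjD n i j =
  let a = suc (toℕ i) ; b = suc (toℕ j) in
  if Dedgeᵇ n a b ∨ Dedgeᵇ n b a then 1ℤ else 0ℤ

ones : ∀ {m} → Vector m
ones _ = 1ℤ

powApply : ∀ {m} → Matrix m → ℕ → Vector m → Vector m
powApply M zero    v = v
powApply M (suc k) v = M · powApply M k v

walkD : (n : ℕ) → Matrix (suc n)
walkD n i j = powApply (adjD n) (toℕ j) ones i

-- W'(D̃_n): zero first row, last row and last two columns; on rows 2..n and
-- columns 1..n-1 (1-based) it agrees with Ŵ(D̃_n), i.e. with W(D̃_n) at the same
-- positions (Ŵ = W with first/last rows and last two columns deleted).
walkD' : (n : ℕ) → Matrix (suc n)
walkD' n i j =
  if ((1 ≤ᵇ toℕ i) ∧ (toℕ i ≤ᵇ (n ∸ 1)) ∧ (toℕ j ≤ᵇ (n ∸ 2)))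
  then walkD n i j else 0ℤ

module Submission where

-- Index the vertices 0, …, n from 0 and let m = n − 2.  The walk vectors of D̃ₙ are folded
-- walks on the infinite path ℤ, whose adjacency operator is T h y = h (y − 1) + h (y + 1):
-- if h is even about 0 and about m, then A carries the vector with entries
-- h(0), h(0), 2h(1), …, 2h(m − 1), h(m), h(m) to the one built in the same way from T h,
-- because the two leaves at either end see their neighbour exactly as the reflections of ℤ
-- at 0 and at m do.  The function G that is 2 on mℤ and 1 elsewhere folds to 2·𝟙, so
-- 2·A^l 𝟙 is the fold of T^l G.  Hence the rows of W at the two leaves of either end
-- coincide, and W c = 0 for every coefficient vector c with c(T) G = 0.  With the Vieta–Lucas
-- polynomials Vₖ(x) = 2Tₖ(x/2), for which Vₖ(T) h y = h (y + k) + h (y − k), such vectors are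
-- q = V_{m+1} − V_{m−1}, monic of degree n − 1, and p = x q − q_{n−2} q, monic of degree n
-- without an x^{n−1} term.  Subtracting row 2 from row 1 and row n from row n + 1, and
-- replacing the last two columns by W q and W p, turns W into W′; both operations are I ± N
-- with N² = 0, hence unimodular.

open import Defs
open import Data.Bool.Base using (Bool; true; false; T; _∧_; _∨_; if_then_else_)
open import Data.Bool.Properties using (T-∨; T-∧; ∨-identityʳ; ∧-assoc)
open import Data.Fin.Base as Fin using (Fin; toℕ)
import Data.Fin.Properties as Fin
open import Data.Integer.Base as ℤ using (ℤ; +_; 0ℤ; 1ℤ; -1ℤ; _+_; _-_; _*_; -_)
open import Data.Integer.Divisibility.Signed
  using (_∣_; _∣?_; divides; ∣-refl; ∣⇒∣ᵤ; ∣m∣n⇒∣m+n; ∣m⇒∣-m; ∣m+n∣m⇒∣n)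
import Data.Integer.Properties as ℤ
open import Data.Integer.Tactic.RingSolver using (solve-∀)
open import Data.Nat.Base as ℕ using (ℕ; zero; suc; _≤_; _<_; _≡ᵇ_; _<ᵇ_; _≤ᵇ_; s≤s; z≤n)
import Data.Nat.Divisibility as ℕ
import Data.Nat.Properties as ℕ
open import Data.Product using (_×_; _,_; proj₁; proj₂)
open import Data.Sum using (_⊎_; inj₁; inj₂)
open import Function.Base using (_∘_)
open import Function.Bundles using (Equivalence; mk⇔)
open import Relation.Binary.PropositionalEquality
open import Relation.Nullary.Decidable using (yes; no; does; does-⇔; dec-true; dec-false)
open import Relation.Nullary.Negation using (¬_; contradiction)

open import Algebra.Properties.Semiring.Sum ℤ.+-*-semiring
  using (sum; sum-cong-≗; ∑-distrib-+; sum-replicate-zero; *-distribˡ-sum)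

open ≡-Reasoning

∑≡sum : ∀ {N} (f : Fin N → ℤ) → ∑ f ≡ sum f
∑≡sum {zero}  f = refl
∑≡sum {suc N} f = cong (λ s → f Fin.zero + s) (∑≡sum (f ∘ Fin.suc))

∑-cong : ∀ {N} {f g : Fin N → ℤ} → (∀ l → f l ≡ g l) → ∑ f ≡ ∑ g
∑-cong {f = f} {g} f≗g = trans (∑≡sum f) (trans (sum-cong-≗ f≗g) (sym (∑≡sum g)))

∑-zero : ∀ N → ∑ {N} (λ _ → 0ℤ) ≡ 0ℤ
∑-zero N = trans (∑≡sum {N} (λ _ → 0ℤ)) (sum-replicate-zero N)

∑-+ : ∀ {N} (f g : Fin N → ℤ) → ∑ (λ l → f l + g l) ≡ ∑ f + ∑ g
∑-+ f g = trans (∑≡sum (λ l → f l + g l))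
                (trans (∑-distrib-+ f g) (sym (cong₂ _+_ (∑≡sum f) (∑≡sum g))))

∑-*ˡ : ∀ {N} c (f : Fin N → ℤ) → ∑ (λ l → c * f l) ≡ c * ∑ f
∑-*ˡ c f = trans (∑≡sum (λ l → c * f l)) (sym (trans (cong (c *_) (∑≡sum f)) (*-distribˡ-sum c f)))

∑-linear : ∀ {N} x y (f g : Fin N → ℤ) → ∑ (λ l → x * f l + y * g l) ≡ x * ∑ f + y * ∑ g
∑-linear x y f g = trans (∑-+ (λ l → x * f l) (λ l → y * g l)) (cong₂ _+_ (∑-*ˡ x f) (∑-*ˡ y g))

∑-- : ∀ {N} (f g : Fin N → ℤ) → ∑ (λ l → f l - g l) ≡ ∑ f - ∑ g
∑-- f g = begin
  ∑ (λ l → f l - g l)        ≡⟨ ∑-+ f _ ⟩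
  ∑ f + ∑ (λ l → - g l)      ≡⟨ cong (λ s → ∑ f + s) (∑-cong (λ l → sym (ℤ.-1*i≡-i (g l)))) ⟩
  ∑ f + ∑ (λ l → -1ℤ * g l)  ≡⟨ cong (λ s → ∑ f + s) (trans (∑-*ˡ -1ℤ g) (ℤ.-1*i≡-i (∑ g))) ⟩
  ∑ f - ∑ g                  ∎

ι : Bool → ℤ
ι b = if b then 1ℤ else 0ℤ

δ : ℕ → ℕ → ℤ
δ a b = ι (a ≡ᵇ b)

if-ι : ∀ b (x : ℤ) → (if b then x else 0ℤ) ≡ ι b * x
if-ι true  x = sym (ℤ.*-identityˡ x)
if-ι false x = refl

if-same : ∀ b (x : ℤ) → (if b then x else x) ≡ x
if-same true  x = refl
if-same false x = refl

true-if-T : ∀ {b} → T b → b ≡ true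
true-if-T {true} _ = refl

false-if-¬T : ∀ {b} → ¬ T b → b ≡ false
false-if-¬T {false} _  = refl
false-if-¬T {true}  ¬t = contradiction _ ¬t

T-∧-split : ∀ x {y} → T (x ∧ y) → T x × T y
T-∧-split x = Equivalence.to (T-∧ {x})

T-∨-split : ∀ x {y} → T (x ∨ y) → T x ⊎ T y
T-∨-split x = Equivalence.to (T-∨ {x})

ι-true : ∀ {b} → T b → ι b ≡ 1ℤ
ι-true t = cong ι (true-if-T t)

ι-false : ∀ {b} → ¬ T b → ι b ≡ 0ℤ
ι-false ¬t = cong ι (false-if-¬T ¬t)

ι-∧ : ∀ x y → ι (x ∧ y) ≡ ι x * ι y
ι-∧ false y = refl
ι-∧ true  y = sym (ℤ.*-identityˡ (ι y))

ι-∨-disjoint : ∀ x y → ¬ (T x × T y) → ι (x ∨ y) ≡ ι x + ι y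
ι-∨-disjoint false y     _    = sym (ℤ.+-identityˡ (ι y))
ι-∨-disjoint true  false _    = refl
ι-∨-disjoint true  true  ¬both = contradiction (_ , _) ¬both

δ-refl : ∀ a → δ a a ≡ 1ℤ
δ-refl a = ι-true (ℕ.≡⇒≡ᵇ a a refl)

δ-≢ : ∀ {a b} → a ≢ b → δ a b ≡ 0ℤ
δ-≢ {a} {b} a≢b = ι-false (a≢b ∘ ℕ.≡ᵇ⇒≡ a b)

δ-comm : ∀ a b → δ a b ≡ δ b a
δ-comm zero    zero    = refl
δ-comm zero    (suc b) = refl
δ-comm (suc a) zero    = refl
δ-comm (suc a) (suc b) = δ-comm a b

∑-select : ∀ {N} (g : Fin N → ℤ) i → ∑ (λ l → δ (toℕ i) (toℕ l) * g l) ≡ g i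
∑-select {suc N} g Fin.zero = begin
  1ℤ * g Fin.zero + ∑ {N} (λ _ → 0ℤ)  ≡⟨ cong₂ _+_ (ℤ.*-identityˡ (g Fin.zero)) (∑-zero N) ⟩
  g Fin.zero + 0ℤ                     ≡⟨ ℤ.+-identityʳ _ ⟩
  g Fin.zero                          ∎
∑-select {suc N} g (Fin.suc i) = trans (ℤ.+-identityˡ _) (∑-select (g ∘ Fin.suc) i)

∑-selectℕ : ∀ {N} (f : ℕ → ℤ) {b} → b < N → ∑ {N} (λ l → δ (toℕ l) b * f (toℕ l)) ≡ f b
∑-selectℕ {N} f {b} b<N = begin
  ∑ {N} (λ l → δ (toℕ l) b * f (toℕ l))
    ≡⟨ ∑-cong {N} (λ l → cong (λ x → δ (toℕ l) x * f (toℕ l)) (sym i≡b)) ⟩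
  ∑ {N} (λ l → δ (toℕ l) (toℕ i) * f (toℕ l))
    ≡⟨ ∑-cong {N} (λ l → cong (_* f (toℕ l)) (δ-comm (toℕ l) (toℕ i))) ⟩
  ∑ {N} (λ l → δ (toℕ i) (toℕ l) * f (toℕ l))
    ≡⟨ ∑-select (f ∘ toℕ) i ⟩
  f (toℕ i)
    ≡⟨ cong f i≡b ⟩
  f b
    ∎
  where
  i = Fin.fromℕ< b<N
  i≡b = Fin.toℕ-fromℕ< b<N

identity-⊗ : ∀ {m} (M : Matrix m) → (identity ⊗ M) ≋ M
identity-⊗ M i j = ∑-select (λ k → M k j) i

⊗-identity : ∀ {m} (M : Matrix m) → (M ⊗ identity) ≋ M
⊗-identity M i j = trans (∑-cong swap) (∑-select (M i) j)
  where
  swap : ∀ k → M i k * identity k j ≡ identity j k * M i k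
  swap k = trans (ℤ.*-comm (M i k) _) (cong (_* M i k) (δ-comm (toℕ k) (toℕ j)))

·-*ˡ : ∀ {m} (A : Matrix m) (v : Vector m) c i → c * (A · v) i ≡ (A · (λ k → c * v k)) i
·-*ˡ A v c i = sym (trans (∑-cong (λ k → swap (A i k) c (v k))) (∑-*ˡ c (λ k → A i k * v k)))
  where
  swap : ∀ a c v → a * (c * v) ≡ c * (a * v)
  swap = solve-∀

⊗-congˡ-scaled : ∀ {m} {A B : Matrix m} (r : Fin m → ℤ) (Q : Matrix m) →
                 (∀ i k → A i k ≡ r i * B i k) → ∀ i j → (A ⊗ Q) i j ≡ r i * (B ⊗ Q) i j
⊗-congˡ-scaled {B = B} r Q A≡rB i j =
  trans (∑-cong (λ k → trans (cong (_* Q k j) (A≡rB i k)) (ℤ.*-assoc (r i) (B i k) (Q k j))))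
        (∑-*ˡ (r i) (λ k → B i k * Q k j))

I+_ I-_ : ∀ {m} → Matrix m → Matrix m
(I+ N) i j = identity i j + N i j
(I- N) i j = identity i j - N i j

*-distribʳ-- : ∀ a b c → (a - b) * c ≡ a * c - b * c
*-distribʳ-- = solve-∀

*-distribˡ-- : ∀ a b c → a * (b - c) ≡ a * b - a * c
*-distribˡ-- = solve-∀

module _ {m} (N M : Matrix m) (i j : Fin m) where

  I+-⊗ : ((I+ N) ⊗ M) i j ≡ M i j + (N ⊗ M) i j
  I+-⊗ = trans (∑-cong (λ k → ℤ.*-distribʳ-+ (M k j) (identity i k) (N i k)))
               (trans (∑-+ (λ k → identity i k * M k j) (λ k → N i k * M k j))
                      (cong (_+ (N ⊗ M) i j) (identity-⊗ M i j)))

  I--⊗ : ((I- N) ⊗ M) i j ≡ M i j - (N ⊗ M) i j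
  I--⊗ = trans (∑-cong (λ k → *-distribʳ-- (identity i k) (N i k) (M k j)))
               (trans (∑-- (λ k → identity i k * M k j) (λ k → N i k * M k j))
                      (cong (_- (N ⊗ M) i j) (identity-⊗ M i j)))

  ⊗-I+ : (M ⊗ (I+ N)) i j ≡ M i j + (M ⊗ N) i j
  ⊗-I+ = trans (∑-cong (λ k → ℤ.*-distribˡ-+ (M i k) (identity k j) (N k j)))
               (trans (∑-+ (λ k → M i k * identity k j) (λ k → M i k * N k j))
                      (cong (_+ (M ⊗ N) i j) (⊗-identity M i j)))

  ⊗-I- : (M ⊗ (I- N)) i j ≡ M i j - (M ⊗ N) i j
  ⊗-I- = trans (∑-cong (λ k → *-distribˡ-- (M i k) (identity k j) (N k j)))
               (trans (∑-- (λ k → M i k * identity k j) (λ k → M i k * N k j))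
                      (cong (_- (M ⊗ N) i j) (⊗-identity M i j)))

SquareZero : ∀ {m} → Matrix m → Set
SquareZero N = ∀ i j → (N ⊗ N) i j ≡ 0ℤ

module _ {m} (N : Matrix m) (N²≡0 : SquareZero N) where

  I+⊗I- : ((I+ N) ⊗ (I- N)) ≋ identity
  I+⊗I- i j = begin
    ((I+ N) ⊗ (I- N)) i j                           ≡⟨ I+-⊗ N (I- N) i j ⟩
    (I- N) i j + (N ⊗ (I- N)) i j                   ≡⟨ cong (λ x → (I- N) i j + x) (⊗-I- N N i j) ⟩
    (identity i j - N i j) + (N i j - (N ⊗ N) i j)  ≡⟨ cong (λ x → (I- N) i j + (N i j - x)) (N²≡0 i j) ⟩
    (identity i j - N i j) + (N i j - 0ℤ)           ≡⟨ cancel (identity i j) (N i j) ⟩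
    identity i j                                    ∎
    where
    cancel : ∀ a b → (a - b) + (b - 0ℤ) ≡ a
    cancel = solve-∀

  I-⊗I+ : ((I- N) ⊗ (I+ N)) ≋ identity
  I-⊗I+ i j = begin
    ((I- N) ⊗ (I+ N)) i j                           ≡⟨ I--⊗ N (I+ N) i j ⟩
    (I+ N) i j - (N ⊗ (I+ N)) i j                   ≡⟨ cong (λ x → (I+ N) i j - x) (⊗-I+ N N i j) ⟩
    (identity i j + N i j) - (N i j + (N ⊗ N) i j)  ≡⟨ cong (λ x → (I+ N) i j - (N i j + x)) (N²≡0 i j) ⟩
    (identity i j + N i j) - (N i j + 0ℤ)           ≡⟨ cancel (identity i j) (N i j) ⟩
    identity i j                                    ∎
    where
    cancel : ∀ a b → (a + b) - (b + 0ℤ) ≡ a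
    cancel = solve-∀

  I+-unimodular : Unimodular (I+ N)
  I+-unimodular = I- N , I+⊗I- , I-⊗I+

  I--unimodular : Unimodular (I- N)
  I--unimodular = I+ N , I-⊗I+ , I+⊗I-

upperBlock : ∀ {m} → ℕ → (ℕ → ℕ → ℤ) → Matrix m
upperBlock c e l j = if toℕ l <ᵇ c then (if toℕ j <ᵇ c then 0ℤ else e (toℕ j) (toℕ l)) else 0ℤ

upperBlock-squareZero : ∀ {m} c e → SquareZero (upperBlock {m} c e)
upperBlock-squareZero {m} c e i j = trans (∑-cong vanish) (∑-zero m)
  where
  vanish : ∀ l → upperBlock c e i l * upperBlock c e l j ≡ 0ℤ
  vanish l with toℕ l <ᵇ c
  ... | true  = cong (_* _) (if-same (toℕ i <ᵇ c) 0ℤ)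
  ... | false = ℤ.*-zeroʳ (if toℕ i <ᵇ c then e (toℕ l) (toℕ i) else 0ℤ)

module _ {m} (c : ℕ) (e : ℕ → ℕ → ℤ) (l j : Fin m) where

  upperBlock-entry : toℕ l < c → c ≤ toℕ j → upperBlock c e l j ≡ e (toℕ j) (toℕ l)
  upperBlock-entry l<c c≤j =
    cong₂ (λ x y → if x then (if y then 0ℤ else e (toℕ j) (toℕ l)) else 0ℤ)
          (true-if-T (ℕ.<⇒<ᵇ l<c)) (false-if-¬T (λ j<ᵇc → ℕ.<⇒≱ (ℕ.<ᵇ⇒< (toℕ j) c j<ᵇc) c≤j))

  upperBlock-below : c ≤ toℕ l → upperBlock c e l j ≡ 0ℤ
  upperBlock-below c≤l =
    cong (λ x → if x then (if toℕ j <ᵇ c then 0ℤ else e (toℕ j) (toℕ l)) else 0ℤ)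
         (false-if-¬T (λ l<ᵇc → ℕ.<⇒≱ (ℕ.<ᵇ⇒< (toℕ l) c l<ᵇc) c≤l))

  upperBlock-left : toℕ j < c → upperBlock c e l j ≡ 0ℤ
  upperBlock-left j<c =
    trans (cong (λ y → if toℕ l <ᵇ c then (if y then 0ℤ else e (toℕ j) (toℕ l)) else 0ℤ)
                (true-if-T (ℕ.<⇒<ᵇ j<c)))
          (if-same (toℕ l <ᵇ c) 0ℤ)

-- Polynomials in the adjacency operator of the path ℤ

pathAdj : (ℤ → ℤ) → ℤ → ℤ
pathAdj h y = h (ℤ.pred y) + h (ℤ.suc y)

pathAdj^ : ℕ → (ℤ → ℤ) → ℤ → ℤ
pathAdj^ zero    h = h
pathAdj^ (suc l) h = pathAdj (pathAdj^ l h)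

-- Polynomials are coefficient sequences; polyAct N reads only the coefficients below N.
polyAct : ℕ → (ℕ → ℤ) → (ℤ → ℤ) → ℤ → ℤ
polyAct N p h y = ∑ {N} (λ l → p (toℕ l) * pathAdj^ (toℕ l) h y)

xTimes : (ℕ → ℤ) → ℕ → ℤ
xTimes p zero    = 0ℤ
xTimes p (suc l) = p l

module _ (N : ℕ) (h : ℤ → ℤ) (y : ℤ) where

  polyAct-xTimes : ∀ p → polyAct (suc N) (xTimes p) h y ≡ pathAdj (polyAct N p h) y
  polyAct-xTimes p = begin
    0ℤ + ∑ (λ l → p (toℕ l) * (g l (ℤ.pred y) + g l (ℤ.suc y)))
      ≡⟨ ℤ.+-identityˡ _ ⟩
    ∑ (λ l → p (toℕ l) * (g l (ℤ.pred y) + g l (ℤ.suc y)))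
      ≡⟨ ∑-cong {N} (λ l → ℤ.*-distribˡ-+ (p (toℕ l)) (g l (ℤ.pred y)) (g l (ℤ.suc y))) ⟩
    ∑ (λ l → p (toℕ l) * g l (ℤ.pred y) + p (toℕ l) * g l (ℤ.suc y))
      ≡⟨ ∑-+ (λ l → p (toℕ l) * g l (ℤ.pred y)) (λ l → p (toℕ l) * g l (ℤ.suc y)) ⟩
    pathAdj (polyAct N p h) y
      ∎
    where
    g : Fin N → ℤ → ℤ
    g l = pathAdj^ (toℕ l) h

  polyAct-- : ∀ p q → polyAct N (λ l → p l - q l) h y ≡ polyAct N p h y - polyAct N q h y
  polyAct-- p q = trans (∑-cong {N} (λ l → *-distribʳ-- (p (toℕ l)) (q (toℕ l)) (g l)))
                        (∑-- {N} (λ l → p (toℕ l) * g l) (λ l → q (toℕ l) * g l))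
    where
    g : Fin N → ℤ
    g l = pathAdj^ (toℕ l) h y

  polyAct-*ˡ : ∀ c p → polyAct N (λ l → c * p l) h y ≡ c * polyAct N p h y
  polyAct-*ˡ c p = trans (∑-cong {N} (λ l → ℤ.*-assoc c (p (toℕ l)) _))
                         (∑-*ˡ {N} c (λ l → p (toℕ l) * pathAdj^ (toℕ l) h y))

unit : ℕ → ℤ
unit l = δ l 0

polyAct-unit : ∀ N h y → polyAct (suc N) unit h y ≡ h y
polyAct-unit N h y = begin
  1ℤ * h y + ∑ {N} (λ _ → 0ℤ)  ≡⟨ cong₂ _+_ (ℤ.*-identityˡ (h y)) (∑-zero N) ⟩
  h y + 0ℤ                     ≡⟨ ℤ.+-identityʳ (h y) ⟩
  h y                          ∎

vietaLucas : ℕ → ℕ → ℤ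
vietaLucas zero          l = + 2 * unit l
vietaLucas (suc zero)    l = xTimes unit l
vietaLucas (suc (suc k)) l = xTimes (vietaLucas (suc k)) l - vietaLucas k l

polyAct-vietaLucas : ∀ k N → k < N → ∀ h y → polyAct N (vietaLucas k) h y ≡ h (y + + k) + h (y - + k)
polyAct-vietaLucas zero (suc N) _ h y = begin
  + 2 * 1ℤ * h y + ∑ {N} (λ _ → 0ℤ)  ≡⟨ cong (λ s → + 2 * 1ℤ * h y + s) (∑-zero N) ⟩
  + 2 * 1ℤ * h y + 0ℤ                ≡⟨ double (h y) ⟩
  h y + h y                          ≡⟨ cong (λ z → h z + h z) (sym (ℤ.+-identityʳ y)) ⟩
  h (y + 0ℤ) + h (y - 0ℤ)            ∎
  where
  double : ∀ x → + 2 * 1ℤ * x + 0ℤ ≡ x + x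
  double = solve-∀
polyAct-vietaLucas (suc zero) (suc zero) (s≤s ())
polyAct-vietaLucas (suc zero) (suc (suc N)) _ h y = begin
  polyAct (2 ℕ.+ N) (xTimes unit) h y
    ≡⟨ polyAct-xTimes (suc N) h y unit ⟩
  polyAct (suc N) unit h (ℤ.pred y) + polyAct (suc N) unit h (ℤ.suc y)
    ≡⟨ cong₂ _+_ (polyAct-unit N h (ℤ.pred y)) (polyAct-unit N h (ℤ.suc y)) ⟩
  h (ℤ.pred y) + h (ℤ.suc y)
    ≡⟨ ℤ.+-comm (h (ℤ.pred y)) (h (ℤ.suc y)) ⟩
  h (ℤ.suc y) + h (ℤ.pred y)
    ≡⟨ cong₂ _+_ (cong h (ℤ.+-comm 1ℤ y)) (cong h (ℤ.+-comm -1ℤ y)) ⟩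
  h (y + 1ℤ) + h (y - 1ℤ)
    ∎
polyAct-vietaLucas (suc (suc k)) (suc N) (s≤s k+1<N) h y = begin
  polyAct (suc N) (λ l → xTimes (vietaLucas (suc k)) l - vietaLucas k l) h y
    ≡⟨ polyAct-- (suc N) h y (xTimes (vietaLucas (suc k))) (vietaLucas k) ⟩
  polyAct (suc N) (xTimes (vietaLucas (suc k))) h y - polyAct (suc N) (vietaLucas k) h y
    ≡⟨ cong₂ _-_ (polyAct-xTimes N h y (vietaLucas (suc k)))
                 (polyAct-vietaLucas k (suc N) k<1+N h y) ⟩
  (g (ℤ.pred y) + g (ℤ.suc y)) - (h (y + K) + h (y - K))
    ≡⟨ cong (λ s → s - (h (y + K) + h (y - K)))
            (cong₂ _+_ (polyAct-vietaLucas (suc k) N k+1<N h (ℤ.pred y))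
                       (polyAct-vietaLucas (suc k) N k+1<N h (ℤ.suc y))) ⟩
  ((h (y′ + K′) + h (y′ - K′)) + (h (y″ + K′) + h (y″ - K′))) - (h (y + K) + h (y - K))
    ≡⟨ cong₂ (λ a b → ((a + h (y′ - K′)) + (h (y″ + K′) + b)) - (h (y + K) + h (y - K)))
             (cong h (down y K)) (cong h (up y K)) ⟩
  ((h (y + K) + h (y′ - K′)) + (h (y″ + K′) + h (y - K))) - (h (y + K) + h (y - K))
    ≡⟨ cancel (h (y + K)) (h (y - K)) (h (y′ - K′)) (h (y″ + K′)) ⟩
  h (y″ + K′) + h (y′ - K′)
    ≡⟨ cong₂ _+_ (cong h (outer+ y K)) (cong h (outer- y K)) ⟩
  h (y + (1ℤ + K′)) + h (y - (1ℤ + K′))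
    ∎
  where
  K = + k
  K′ = 1ℤ + K
  y′ = ℤ.pred y
  y″ = ℤ.suc y
  g = polyAct N (vietaLucas (suc k)) h
  k<1+N = ℕ.<-trans (ℕ.n<1+n k) (ℕ.m<n⇒m<1+n k+1<N)
  down : ∀ y K → (-1ℤ + y) + (1ℤ + K) ≡ y + K
  down = solve-∀
  up : ∀ y K → (1ℤ + y) - (1ℤ + K) ≡ y - K
  up = solve-∀
  outer+ : ∀ y K → (1ℤ + y) + (1ℤ + K) ≡ y + (1ℤ + (1ℤ + K))
  outer+ = solve-∀
  outer- : ∀ y K → (-1ℤ + y) - (1ℤ + K) ≡ y - (1ℤ + (1ℤ + K))
  outer- = solve-∀
  cancel : ∀ a b c d → ((a + c) + (d + b)) - (a + b) ≡ d + c
  cancel = solve-∀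

vietaLucas-vanish : ∀ k l → k < l → vietaLucas k l ≡ 0ℤ
vietaLucas-vanish zero          (suc l)       _ = refl
vietaLucas-vanish (suc zero)    (suc zero)    (s≤s ())
vietaLucas-vanish (suc zero)    (suc (suc l)) _ = refl
vietaLucas-vanish (suc (suc k)) (suc l)       (s≤s k+1<l) =
  cong₂ _-_ (vietaLucas-vanish (suc k) l k+1<l)
            (vietaLucas-vanish k (suc l) (ℕ.<-trans (ℕ.n<1+n k) (ℕ.m<n⇒m<1+n k+1<l)))

vietaLucas-leading : ∀ k → vietaLucas (suc k) (suc k) ≡ 1ℤ
vietaLucas-leading zero    = refl
vietaLucas-leading (suc k) =
  cong₂ _-_ (vietaLucas-leading k) (vietaLucas-vanish k (2 ℕ.+ k) (ℕ.m<n⇒m<1+n (ℕ.n<1+n k)))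

EvenAbout : ℤ → (ℤ → ℤ) → Set
EvenAbout c h = ∀ y → h (c + y) ≡ h (c - y)

pathAdj-evenAbout : ∀ c h → EvenAbout c h → EvenAbout c (pathAdj h)
pathAdj-evenAbout c h even y = begin
  h (-1ℤ + (c + y)) + h (1ℤ + (c + y))  ≡⟨ cong₂ _+_ (cong h (shift -1ℤ c y)) (cong h (shift 1ℤ c y)) ⟩
  h (c + (-1ℤ + y)) + h (c + (1ℤ + y))  ≡⟨ cong₂ _+_ (even (-1ℤ + y)) (even (1ℤ + y)) ⟩
  h (c - (-1ℤ + y)) + h (c - (1ℤ + y))  ≡⟨ cong₂ _+_ (cong h (reflect 1ℤ c y)) (cong h (reflect -1ℤ c y)) ⟩
  h (1ℤ + (c - y)) + h (-1ℤ + (c - y))  ≡⟨ ℤ.+-comm (h (1ℤ + (c - y))) (h (-1ℤ + (c - y))) ⟩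
  h (-1ℤ + (c - y)) + h (1ℤ + (c - y))  ∎
  where
  shift : ∀ e c y → e + (c + y) ≡ c + (e + y)
  shift = solve-∀
  reflect : ∀ e c y → c - (- e + y) ≡ e + (c - y)
  reflect = solve-∀

pathAdj^-evenAbout : ∀ c h → EvenAbout c h → ∀ l → EvenAbout c (pathAdj^ l h)
pathAdj^-evenAbout c h even zero    = even
pathAdj^-evenAbout c h even (suc l) = pathAdj-evenAbout c (pathAdj^ l h) (pathAdj^-evenAbout c h even l)

evenAbout-periodic : ∀ c h → EvenAbout 0ℤ h → EvenAbout c h → ∀ y → h (c + y) ≡ h (y - c)
evenAbout-periodic c h even₀ even y = begin
  h (c + y)         ≡⟨ even y ⟩
  h (c - y)         ≡⟨ cong h (sym (ℤ.+-identityˡ (c - y))) ⟩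
  h (0ℤ + (c - y))  ≡⟨ even₀ (c - y) ⟩
  h (0ℤ - (c - y))  ≡⟨ cong h (flip c y) ⟩
  h (y - c)         ∎
  where
  flip : ∀ c y → 0ℤ - (c - y) ≡ y - c
  flip = solve-∀

-- Indexed by r = m − 1.
annihilator : ℕ → ℕ → ℤ
annihilator r l = vietaLucas (2 ℕ.+ r) l - vietaLucas r l

annihilator⁺ : ℕ → ℕ → ℤ
annihilator⁺ r l = xTimes (annihilator r) l - annihilator r (suc r) * annihilator r l

annihilator-leading : ∀ r → annihilator r (2 ℕ.+ r) ≡ 1ℤ
annihilator-leading r =
  cong₂ _-_ (vietaLucas-leading (suc r))
            (vietaLucas-vanish r (2 ℕ.+ r) (ℕ.<-trans (ℕ.n<1+n r) (ℕ.n<1+n (suc r))))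

annihilator-vanish : ∀ r → annihilator r (3 ℕ.+ r) ≡ 0ℤ
annihilator-vanish r =
  cong₂ _-_ (vietaLucas-vanish (2 ℕ.+ r) (3 ℕ.+ r) (ℕ.n<1+n (2 ℕ.+ r)))
            (vietaLucas-vanish r (3 ℕ.+ r) (ℕ.m<n⇒m<1+n (ℕ.m<n⇒m<1+n (ℕ.n<1+n r))))

annihilator⁺-vanish : ∀ r → annihilator⁺ r (2 ℕ.+ r) ≡ 0ℤ
annihilator⁺-vanish r = begin
  c - c * annihilator r (2 ℕ.+ r)  ≡⟨ cong (λ a → c - c * a) (annihilator-leading r) ⟩
  c - c * 1ℤ                       ≡⟨ cong (λ a → c - a) (ℤ.*-identityʳ c) ⟩
  c - c                            ≡⟨ ℤ.+-inverseʳ c ⟩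
  0ℤ                               ∎
  where
  c = annihilator r (suc r)

annihilator⁺-leading : ∀ r → annihilator⁺ r (3 ℕ.+ r) ≡ 1ℤ
annihilator⁺-leading r = begin
  annihilator r (2 ℕ.+ r) - c * annihilator r (3 ℕ.+ r)
    ≡⟨ cong₂ (λ a b → a - c * b) (annihilator-leading r) (annihilator-vanish r) ⟩
  1ℤ - c * 0ℤ
    ≡⟨ cong (λ a → 1ℤ - a) (ℤ.*-zeroʳ c) ⟩
  1ℤ
    ∎
  where
  c = annihilator r (suc r)

module _ (r : ℕ) (h : ℤ → ℤ) (even₀ : EvenAbout 0ℤ h) (evenₘ : EvenAbout (+ suc r) h) where

  polyAct-annihilator : ∀ N → 2 ℕ.+ r < N → ∀ y → polyAct N (annihilator r) h y ≡ 0ℤ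
  polyAct-annihilator N 2+r<N y = begin
    polyAct N (annihilator r) h y
      ≡⟨ polyAct-- N h y (vietaLucas (2 ℕ.+ r)) (vietaLucas r) ⟩
    polyAct N (vietaLucas (2 ℕ.+ r)) h y - polyAct N (vietaLucas r) h y
      ≡⟨ cong₂ _-_ (polyAct-vietaLucas (2 ℕ.+ r) N 2+r<N h y) (polyAct-vietaLucas r N r<N h y) ⟩
    (h (y + (1ℤ + (1ℤ + R))) + h (y - (1ℤ + (1ℤ + R)))) - (h (y + R) + h (y - R))
      ≡⟨ cong₂ (λ a b → (a + b) - (h (y + R) + h (y - R))) far-right far-left ⟩
    (h (y - R) + h (y + R)) - (h (y + R) + h (y - R))
      ≡⟨ cancel (h (y - R)) (h (y + R)) ⟩
    0ℤ
      ∎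
    where
    R = + r
    r<N = ℕ.<-trans (ℕ.n<1+n r) (ℕ.<-trans (ℕ.n<1+n (suc r)) 2+r<N)
    periodic = evenAbout-periodic (1ℤ + R) h even₀ evenₘ
    far-right : h (y + (1ℤ + (1ℤ + R))) ≡ h (y - R)
    far-right = trans (cong h (into y R)) (trans (periodic (1ℤ + y)) (cong h (out y R)))
      where
      into : ∀ y R → y + (1ℤ + (1ℤ + R)) ≡ (1ℤ + R) + (1ℤ + y)
      into = solve-∀
      out : ∀ y R → (1ℤ + y) - (1ℤ + R) ≡ y - R
      out = solve-∀
    far-left : h (y - (1ℤ + (1ℤ + R))) ≡ h (y + R)
    far-left = trans (cong h (into y R)) (trans (sym (periodic (-1ℤ + y))) (cong h (out y R)))
      where
      into : ∀ y R → y - (1ℤ + (1ℤ + R)) ≡ (-1ℤ + y) - (1ℤ + R)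
      into = solve-∀
      out : ∀ y R → (1ℤ + R) + (-1ℤ + y) ≡ y + R
      out = solve-∀
    cancel : ∀ a b → (a + b) - (b + a) ≡ 0ℤ
    cancel = solve-∀

  polyAct-annihilator⁺ : ∀ N → 3 ℕ.+ r < N → ∀ y → polyAct N (annihilator⁺ r) h y ≡ 0ℤ
  polyAct-annihilator⁺ (suc N) (s≤s 2+r<N) y = begin
    polyAct (suc N) (annihilator⁺ r) h y
      ≡⟨ polyAct-- (suc N) h y (xTimes (annihilator r)) (λ l → c * annihilator r l) ⟩
    polyAct (suc N) (xTimes (annihilator r)) h y - polyAct (suc N) (λ l → c * annihilator r l) h y
      ≡⟨ cong₂ _-_ (polyAct-xTimes N h y (annihilator r)) (polyAct-*ˡ (suc N) h y c (annihilator r)) ⟩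
    (q (ℤ.pred y) + q (ℤ.suc y)) - c * polyAct (suc N) (annihilator r) h y
      ≡⟨ cong₂ (λ a b → (a + b) - c * polyAct (suc N) (annihilator r) h y)
               (polyAct-annihilator N 2+r<N (ℤ.pred y)) (polyAct-annihilator N 2+r<N (ℤ.suc y)) ⟩
    (0ℤ + 0ℤ) - c * polyAct (suc N) (annihilator r) h y
      ≡⟨ cong (λ a → 0ℤ - c * a) (polyAct-annihilator (suc N) (ℕ.m<n⇒m<1+n 2+r<N) y) ⟩
    0ℤ - c * 0ℤ
      ≡⟨ cong (λ a → 0ℤ - a) (ℤ.*-zeroʳ c) ⟩
    0ℤ
      ∎
    where
    c = annihilator r (suc r)
    q = polyAct N (annihilator r) h

∣-reflect : ∀ {d c y} → d ∣ c → d ∣ c + y → d ∣ c - y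
∣-reflect d∣c d∣c+y = ∣m∣n⇒∣m+n d∣c (∣m⇒∣-m (∣m+n∣m⇒∣n d∣c+y d∣c))

∣?-evenAbout : ∀ {d c} → d ∣ c → ∀ y → does (d ∣? (c + y)) ≡ does (d ∣? (c - y))
∣?-evenAbout {d} {c} d∣c y = does-⇔ (mk⇔ (∣-reflect d∣c) back) (d ∣? (c + y)) (d ∣? (c - y))
  where
  back : d ∣ c - y → d ∣ c + y
  back d∣c-y = subst (λ z → d ∣ c + z) (ℤ.neg-involutive y) (∣-reflect d∣c d∣c-y)

-- The graph D̃ₙ, for n = 4 + k

-- Vertex v of the paper is index v − 1: the leaves 0 and 1 hang on 2, the spine is
-- 2, …, 2 + k, and the leaves 3 + k and 4 + k hang on 2 + k.
module _ (k : ℕ) where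

  private
    n : ℕ
    n = 4 ℕ.+ k

  clause-increasing : ∀ {x y} p q → p < q → T ((x ≡ᵇ p) ∧ (y ≡ᵇ q)) → x < y
  clause-increasing {x} {y} p q p<q t with T-∧-split (x ≡ᵇ p) t
  ... | x≡ᵇp , y≡ᵇq rewrite ℕ.≡ᵇ⇒≡ x p x≡ᵇp | ℕ.≡ᵇ⇒≡ y q y≡ᵇq = p<q

  spine-clause-increasing : ∀ {x y} → T ((3 ≤ᵇ x) ∧ ((x ≤ᵇ 2 ℕ.+ k) ∧ (y ≡ᵇ suc x))) → x < y
  spine-clause-increasing {x} {y} t with T-∧-split (3 ≤ᵇ x) t
  ... | _ , t′ with T-∧-split (x ≤ᵇ 2 ℕ.+ k) t′
  ...   | _ , y≡ᵇ1+x rewrite ℕ.≡ᵇ⇒≡ y (suc x) y≡ᵇ1+x = ℕ.n<1+n x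

  Dedge-increasing : ∀ x y → T (Dedgeᵇ n x y) → x < y
  Dedge-increasing x y edge with T-∨-split ((x ≡ᵇ 1) ∧ (y ≡ᵇ 3)) edge
  ... | inj₁ e = clause-increasing 1 3 (s≤s (s≤s z≤n)) e
  ... | inj₂ edge′ with T-∨-split ((x ≡ᵇ 2) ∧ (y ≡ᵇ 3)) edge′
  ...   | inj₁ e = clause-increasing 2 3 (s≤s (s≤s (s≤s z≤n))) e
  ...   | inj₂ edge″ with T-∨-split ((x ≡ᵇ 3 ℕ.+ k) ∧ (y ≡ᵇ 4 ℕ.+ k)) edge″
  ...     | inj₁ e = clause-increasing (3 ℕ.+ k) (4 ℕ.+ k) (ℕ.n<1+n _) e
  ...     | inj₂ edge‴ with T-∨-split ((x ≡ᵇ 3 ℕ.+ k) ∧ (y ≡ᵇ 5 ℕ.+ k)) edge‴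
  ...       | inj₁ e = clause-increasing (3 ℕ.+ k) (5 ℕ.+ k) (ℕ.m<n⇒m<1+n (ℕ.n<1+n _)) e
  ...       | inj₂ e = spine-clause-increasing e

  spine : ℕ → ℤ
  spine d = ι (d <ᵇ k)

  spine-true : ∀ {d} → d < k → spine d ≡ 1ℤ
  spine-true d<k = ι-true (ℕ.<⇒<ᵇ d<k)

  spine-false : ∀ {d} → k ≤ d → spine d ≡ 0ℤ
  spine-false {d} k≤d = ι-false (λ d<ᵇk → ℕ.<⇒≱ (ℕ.<ᵇ⇒< d k d<ᵇk) k≤d)

  edgeUp : ℕ → ℕ → ℤ
  edgeUp 0             c = δ c 2
  edgeUp 1             c = δ c 2
  edgeUp (suc (suc d)) c = δ d k * (δ c (3 ℕ.+ k) + δ c (4 ℕ.+ k)) + spine d * δ c (3 ℕ.+ d)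

  ι-Dedge : ∀ a c → ι (Dedgeᵇ n (suc a) (suc c)) ≡ edgeUp a c
  ι-Dedge 0 c = cong ι (∨-identityʳ (c ≡ᵇ 2))
  ι-Dedge 1 c = cong ι (∨-identityʳ (c ≡ᵇ 2))
  ι-Dedge (suc (suc d)) c = begin
    ι (leaf₃ ∨ (leaf₄ ∨ path))
      ≡⟨ ι-∨-disjoint leaf₃ (leaf₄ ∨ path) disjoint₃ ⟩
    ι leaf₃ + ι (leaf₄ ∨ path)
      ≡⟨ cong (λ x → ι leaf₃ + x) (ι-∨-disjoint leaf₄ path disjoint₄) ⟩
    ι leaf₃ + (ι leaf₄ + ι path)
      ≡⟨ cong₂ (λ x y → x + (y + ι path)) (ι-∧ (d ≡ᵇ k) _) (ι-∧ (d ≡ᵇ k) _) ⟩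
    δ d k * δ c (3 ℕ.+ k) + (δ d k * δ c (4 ℕ.+ k) + ι path)
      ≡⟨ cong (λ z → δ d k * δ c (3 ℕ.+ k) + (δ d k * δ c (4 ℕ.+ k) + z)) (ι-∧ (d <ᵇ k) _) ⟩
    δ d k * δ c (3 ℕ.+ k) + (δ d k * δ c (4 ℕ.+ k) + spine d * δ c (3 ℕ.+ d))
      ≡⟨ regroup (δ d k) _ _ _ ⟩
    edgeUp (suc (suc d)) c
      ∎
    where
    leaf₃ = (d ≡ᵇ k) ∧ (c ≡ᵇ 3 ℕ.+ k)
    leaf₄ = (d ≡ᵇ k) ∧ (c ≡ᵇ 4 ℕ.+ k)
    path  = (d <ᵇ k) ∧ (c ≡ᵇ 3 ℕ.+ d)
    not-spine : T (d ≡ᵇ k) → ¬ T (d <ᵇ k)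
    not-spine d≡ᵇk d<ᵇk rewrite ℕ.≡ᵇ⇒≡ d k d≡ᵇk = ℕ.<-irrefl refl (ℕ.<ᵇ⇒< k k d<ᵇk)
    disjoint₄ : ¬ (T leaf₄ × T path)
    disjoint₄ (t₄ , t) = not-spine (proj₁ (T-∧-split (d ≡ᵇ k) t₄)) (proj₁ (T-∧-split (d <ᵇ k) t))
    disjoint₃ : ¬ (T leaf₃ × T (leaf₄ ∨ path))
    disjoint₃ (t₃ , t) with T-∧-split (d ≡ᵇ k) t₃ | T-∨-split leaf₄ t
    ... | _ , c≡ᵇ3+k | inj₁ t₄ =
      ℕ.1+n≢n (trans (sym (ℕ.≡ᵇ⇒≡ c _ (proj₂ (T-∧-split (d ≡ᵇ k) t₄))))
                     (ℕ.≡ᵇ⇒≡ c _ c≡ᵇ3+k))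
    ... | d≡ᵇk , _   | inj₂ t′ = not-spine d≡ᵇk (proj₁ (T-∧-split (d <ᵇ k) t′))
    regroup : ∀ x p q r → x * p + (x * q + r) ≡ x * (p + q) + r
    regroup = solve-∀

  adjD-entry : ∀ i l → adjD n i l ≡ edgeUp (toℕ i) (toℕ l) + edgeUp (toℕ l) (toℕ i)
  adjD-entry i l = begin
    ι (Dedgeᵇ n (suc a) (suc c) ∨ Dedgeᵇ n (suc c) (suc a))
      ≡⟨ ι-∨-disjoint (Dedgeᵇ n (suc a) (suc c)) _ antisymmetric ⟩
    ι (Dedgeᵇ n (suc a) (suc c)) + ι (Dedgeᵇ n (suc c) (suc a))
      ≡⟨ cong₂ _+_ (ι-Dedge a c) (ι-Dedge c a) ⟩
    edgeUp a c + edgeUp c a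
      ∎
    where
    a = toℕ i
    c = toℕ l
    antisymmetric : ¬ (T (Dedgeᵇ n (suc a) (suc c)) × T (Dedgeᵇ n (suc c) (suc a)))
    antisymmetric (ac , ca) = ℕ.<-asym (Dedge-increasing (suc a) (suc c) ac) (Dedge-increasing (suc c) (suc a) ca)

  upSum : (ℕ → ℤ) → ℕ → ℤ
  upSum u 0             = u 2
  upSum u 1             = u 2
  upSum u (suc (suc d)) = δ d k * (u (3 ℕ.+ k) + u (4 ℕ.+ k)) + spine d * u (3 ℕ.+ d)

  downSum : (ℕ → ℤ) → ℕ → ℤ
  downSum u 0                   = 0ℤ
  downSum u 1                   = 0ℤ
  downSum u 2                   = u 0 + u 1
  downSum u (suc (suc (suc e))) = (δ e k + δ e (suc k)) * u (2 ℕ.+ k) + spine e * u (2 ℕ.+ e)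

  spine-select : ∀ d (f : ℕ → ℤ) →
                 spine d * ∑ {suc n} (λ l → δ (toℕ l) (3 ℕ.+ d) * f (toℕ l)) ≡ spine d * f (3 ℕ.+ d)
  spine-select d f with d ℕ.<? k
  ... | yes d<k = cong (spine d *_) (∑-selectℕ f (s≤s (s≤s (s≤s (ℕ.m<n⇒m<1+n (ℕ.m<n⇒m<1+n d<k))))))
  ... | no  d≮k = trans (cong (_* selected) no-spine) (sym (cong (_* f (3 ℕ.+ d)) no-spine))
    where
    selected = ∑ {suc n} (λ l → δ (toℕ l) (3 ℕ.+ d) * f (toℕ l))
    no-spine = spine-false (ℕ.≮⇒≥ d≮k)

  upSum-∑ : ∀ u a → ∑ {suc n} (λ l → edgeUp a (toℕ l) * u (toℕ l)) ≡ upSum u a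
  upSum-∑ u 0 = ∑-selectℕ {suc n} u (s≤s (s≤s (s≤s z≤n)))
  upSum-∑ u 1 = ∑-selectℕ {suc n} u (s≤s (s≤s (s≤s z≤n)))
  upSum-∑ u (suc (suc d)) = begin
    ∑ {suc n} (λ l → edgeUp (suc (suc d)) (toℕ l) * u (toℕ l))
      ≡⟨ ∑-cong {suc n} (λ l → expand (δ d k) (δ (toℕ l) R₃) (δ (toℕ l) R₄)
                                      (spine d) (δ (toℕ l) (3 ℕ.+ d)) (u (toℕ l))) ⟩
    ∑ (λ l → δ d k * (at R₃ l + at R₄ l) + spine d * at (3 ℕ.+ d) l)
      ≡⟨ ∑-linear (δ d k) (spine d) (λ l → at R₃ l + at R₄ l) (at (3 ℕ.+ d)) ⟩
    δ d k * ∑ (λ l → at R₃ l + at R₄ l) + spine d * ∑ (at (3 ℕ.+ d))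
      ≡⟨ cong₂ (λ x y → δ d k * x + y) (∑-+ (at R₃) (at R₄)) (spine-select d u) ⟩
    δ d k * (∑ (at R₃) + ∑ (at R₄)) + spine d * u (3 ℕ.+ d)
      ≡⟨ cong (λ x → δ d k * x + spine d * u (3 ℕ.+ d))
              (cong₂ _+_ (∑-selectℕ u (ℕ.m<n⇒m<1+n (ℕ.n<1+n R₃))) (∑-selectℕ u (ℕ.n<1+n R₄))) ⟩
    upSum u (suc (suc d))
      ∎
    where
    R₃ = 3 ℕ.+ k
    R₄ = 4 ℕ.+ k
    at : ℕ → Fin (suc n) → ℤ
    at b l = δ (toℕ l) b * u (toℕ l)
    expand : ∀ x p q s t w → (x * (p + q) + s * t) * w ≡ x * (p * w + q * w) + s * (t * w)
    expand = solve-∀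

  private
    no-edges-down-to-leaves : ∀ (u : ℕ → ℤ) →
      ∑ {3 ℕ.+ k} (λ l → (δ (toℕ l) k * 0ℤ + spine (toℕ l) * 0ℤ) * u (2 ℕ.+ toℕ l)) ≡ 0ℤ
    no-edges-down-to-leaves u =
      trans (∑-cong {3 ℕ.+ k} (λ l → vanish (δ (toℕ l) k) (spine (toℕ l)) (u (2 ℕ.+ toℕ l))))
            (∑-zero (3 ℕ.+ k))
      where
      vanish : ∀ x y w → (x * 0ℤ + y * 0ℤ) * w ≡ 0ℤ
      vanish = solve-∀

  downSum-∑ : ∀ u a → a ≤ n → ∑ {suc n} (λ l → edgeUp (toℕ l) a * u (toℕ l)) ≡ downSum u a
  downSum-∑ u 0 _ = cong (λ s → 0ℤ + (0ℤ + s)) (no-edges-down-to-leaves u)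
  downSum-∑ u 1 _ = cong (λ s → 0ℤ + (0ℤ + s)) (no-edges-down-to-leaves u)
  downSum-∑ u 2 _ = trans (cong (λ s → 1ℤ * u 0 + (1ℤ * u 1 + s)) (no-edges-down-to-leaves u)) (units (u 0) (u 1))
    where
    units : ∀ x y → 1ℤ * x + (1ℤ * y + 0ℤ) ≡ x + y
    units = solve-∀
  downSum-∑ u (suc (suc (suc e))) 3+e≤n = begin
    0ℤ + (0ℤ + ∑ {3 ℕ.+ k} (λ l → (δ (toℕ l) k * A + spine (toℕ l) * δ e (toℕ l)) * f (toℕ l)))
      ≡⟨ trans (ℤ.+-identityˡ _) (ℤ.+-identityˡ _) ⟩
    ∑ {3 ℕ.+ k} (λ l → (δ (toℕ l) k * A + spine (toℕ l) * δ e (toℕ l)) * f (toℕ l))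
      ≡⟨ ∑-cong {3 ℕ.+ k} (λ l → trans (regroup (δ (toℕ l) k) A (spine (toℕ l)) (δ e (toℕ l)) (f (toℕ l)))
                                         (cong (λ x → A * (δ (toℕ l) k * f (toℕ l)) + x * g (toℕ l))
                                               (δ-comm e (toℕ l)))) ⟩
    ∑ {3 ℕ.+ k} (λ l → A * (δ (toℕ l) k * f (toℕ l)) + δ (toℕ l) e * g (toℕ l))
      ≡⟨ ∑-+ {3 ℕ.+ k} (λ l → A * (δ (toℕ l) k * f (toℕ l))) (λ l → δ (toℕ l) e * g (toℕ l)) ⟩
    ∑ {3 ℕ.+ k} (λ l → A * (δ (toℕ l) k * f (toℕ l))) + ∑ {3 ℕ.+ k} (λ l → δ (toℕ l) e * g (toℕ l))
      ≡⟨ cong₂ _+_ (trans (∑-*ˡ {3 ℕ.+ k} A (λ l → δ (toℕ l) k * f (toℕ l)))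
                          (cong (A *_) (∑-selectℕ {3 ℕ.+ k} f k<3+k)))
                   (∑-selectℕ {3 ℕ.+ k} g e<3+k) ⟩
    A * f k + g e
      ∎
    where
    A = δ e k + δ e (suc k)
    f g : ℕ → ℤ
    f d = u (2 ℕ.+ d)
    g d = spine d * u (2 ℕ.+ d)
    k<3+k = s≤s (ℕ.m≤n⇒m≤1+n (ℕ.n≤1+n k))
    e<3+k = s≤s (ℕ.m≤n⇒m≤1+n (ℕ.≤-pred (ℕ.≤-pred (ℕ.≤-pred 3+e≤n))))
    regroup : ∀ x a s t w → (x * a + s * t) * w ≡ a * (x * w) + t * (s * w)
    regroup = solve-∀

  adjD-row : ∀ (u : ℕ → ℤ) i → (adjD n · (u ∘ toℕ)) i ≡ upSum u (toℕ i) + downSum u (toℕ i)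
  adjD-row u i = begin
    ∑ (λ l → adjD n i l * u (toℕ l))
      ≡⟨ ∑-cong {suc n} (λ l → trans (cong (_* u (toℕ l)) (adjD-entry i l))
                                     (ℤ.*-distribʳ-+ (u (toℕ l)) (edgeUp a (toℕ l)) (edgeUp (toℕ l) a))) ⟩
    ∑ {suc n} (λ l → up l + down l)
      ≡⟨ ∑-+ {suc n} up down ⟩
    ∑ {suc n} up + ∑ {suc n} down
      ≡⟨ cong₂ _+_ (upSum-∑ u a) (downSum-∑ u a (ℕ.≤-pred (Fin.toℕ<n i))) ⟩
    upSum u a + downSum u a
      ∎
    where
    a = toℕ i
    up down : Fin (suc n) → ℤ
    up   l = edgeUp a (toℕ l) * u (toℕ l)
    down l = edgeUp (toℕ l) a * u (toℕ l)

  m : ℤ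
  m = + (2 ℕ.+ k)

  -- Index a lies over the point foldPoint a of the path 0, …, m, with weight 1 at the
  -- four leaves and 2 on the spine.
  foldWeight foldPoint : ℕ → ℤ
  foldWeight zero          = 1ℤ
  foldWeight (suc zero)    = 1ℤ
  foldWeight (suc (suc d)) = if d ≤ᵇ k then + 2 else 1ℤ
  foldPoint zero          = 0ℤ
  foldPoint (suc zero)    = 0ℤ
  foldPoint (suc (suc d)) = if d ≤ᵇ k then + suc d else m

  fold : (ℤ → ℤ) → ℕ → ℤ
  fold h a = foldWeight a * h (foldPoint a)

  fold-spine : ∀ h {d} → d ≤ k → fold h (2 ℕ.+ d) ≡ + 2 * h (+ suc d)
  fold-spine h {d} d≤k with d ≤ᵇ k | ℕ.≤⇒≤ᵇ d≤k
  ... | true | _ = refl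

  fold-rightLeaf : ∀ h {d} → k < d → fold h (2 ℕ.+ d) ≡ 1ℤ * h m
  fold-rightLeaf h {d} k<d with d ≤ᵇ k | ℕ.≤ᵇ⇒≤ d k
  ... | false | _   = refl
  ... | true  | d≤k = contradiction (d≤k _) (ℕ.<⇒≱ k<d)

  rightLeaf-indicator : ∀ {e} → k ≤ e → e ≤ suc k → δ e k + δ e (suc k) ≡ 1ℤ
  rightLeaf-indicator {e} k≤e e≤1+k with ℕ.m≤n⇒m<n∨m≡n k≤e
  ... | inj₂ refl = cong₂ _+_ (δ-refl k) (δ-≢ (ℕ.<⇒≢ (ℕ.n<1+n k)))
  ... | inj₁ k<e with ℕ.≤-antisym k<e e≤1+k
  ...   | refl = cong₂ _+_ (δ-≢ (ℕ.1+n≢n {k})) (δ-refl (suc k))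

  module _ (h : ℤ → ℤ) (even₀ : EvenAbout 0ℤ h) (evenₘ : EvenAbout m h) where

    private
      F : ℕ → ℤ
      F = fold h

    leftLeaf-neighbours : upSum F 0 + downSum F 0 ≡ fold (pathAdj h) 0
    leftLeaf-neighbours = trans (double (h 1ℤ)) (cong (λ x → 1ℤ * (x + h 1ℤ)) (even₀ 1ℤ))
      where
      double : ∀ x → + 2 * x + 0ℤ ≡ 1ℤ * (x + x)
      double = solve-∀

    spine-upSum : ∀ {d} → d ≤ k → upSum F (2 ℕ.+ d) ≡ + 2 * h (+ (2 ℕ.+ d))
    spine-upSum {d} d≤k with ℕ.m≤n⇒m<n∨m≡n d≤k
    ... | inj₂ refl = begin
      δ d d * (F (3 ℕ.+ d) + F (4 ℕ.+ d)) + spine d * F (3 ℕ.+ d)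
        ≡⟨ cong₂ (λ x y → x * (F (3 ℕ.+ d) + F (4 ℕ.+ d)) + y * F (3 ℕ.+ d))
                 (δ-refl d) (spine-false ℕ.≤-refl) ⟩
      1ℤ * (F (3 ℕ.+ d) + F (4 ℕ.+ d)) + 0ℤ
        ≡⟨ cong₂ (λ x y → 1ℤ * (x + y) + 0ℤ)
                 (fold-rightLeaf h (ℕ.n<1+n d)) (fold-rightLeaf h (ℕ.m<n⇒m<1+n (ℕ.n<1+n d))) ⟩
      1ℤ * (1ℤ * h m + 1ℤ * h m) + 0ℤ
        ≡⟨ double (h m) ⟩
      + 2 * h m
        ∎
      where
      double : ∀ x → 1ℤ * (1ℤ * x + 1ℤ * x) + 0ℤ ≡ + 2 * x
      double = solve-∀
    ... | inj₁ d<k = begin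
      δ d k * (F (3 ℕ.+ k) + F (4 ℕ.+ k)) + spine d * F (3 ℕ.+ d)
        ≡⟨ cong₂ (λ x y → x * (F (3 ℕ.+ k) + F (4 ℕ.+ k)) + y * F (3 ℕ.+ d))
                 (δ-≢ (ℕ.<⇒≢ d<k)) (spine-true d<k) ⟩
      0ℤ + 1ℤ * F (3 ℕ.+ d)
        ≡⟨ cong (λ x → 0ℤ + 1ℤ * x) (fold-spine h d<k) ⟩
      0ℤ + 1ℤ * (+ 2 * h (+ (2 ℕ.+ d)))
        ≡⟨ trans (ℤ.+-identityˡ _) (ℤ.*-identityˡ _) ⟩
      + 2 * h (+ (2 ℕ.+ d))
        ∎

    spine-downSum : ∀ {d} → d ≤ k → downSum F (2 ℕ.+ d) ≡ + 2 * h (+ d)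
    spine-downSum {zero}  _   = double (h 0ℤ)
      where
      double : ∀ x → 1ℤ * x + 1ℤ * x ≡ + 2 * x
      double = solve-∀
    spine-downSum {suc e} e<k = begin
      (δ e k + δ e (suc k)) * F (2 ℕ.+ k) + spine e * F (2 ℕ.+ e)
        ≡⟨ cong₂ (λ x y → x * F (2 ℕ.+ k) + y * F (2 ℕ.+ e))
                 (cong₂ _+_ (δ-≢ (ℕ.<⇒≢ e<k)) (δ-≢ (ℕ.<⇒≢ (ℕ.m<n⇒m<1+n e<k)))) (spine-true e<k) ⟩
      0ℤ + 1ℤ * F (2 ℕ.+ e)
        ≡⟨ cong (λ x → 0ℤ + 1ℤ * x) (fold-spine h (ℕ.<⇒≤ e<k)) ⟩
      0ℤ + 1ℤ * (+ 2 * h (+ suc e))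
        ≡⟨ trans (ℤ.+-identityˡ _) (ℤ.*-identityˡ _) ⟩
      + 2 * h (+ suc e)
        ∎

    spine-neighbours : ∀ {d} → d ≤ k → upSum F (2 ℕ.+ d) + downSum F (2 ℕ.+ d) ≡ fold (pathAdj h) (2 ℕ.+ d)
    spine-neighbours {d} d≤k = begin
      upSum F (2 ℕ.+ d) + downSum F (2 ℕ.+ d)
        ≡⟨ cong₂ _+_ (spine-upSum d≤k) (spine-downSum d≤k) ⟩
      + 2 * h (+ (2 ℕ.+ d)) + + 2 * h (+ d)
        ≡⟨ factor (h (+ (2 ℕ.+ d))) (h (+ d)) ⟩
      + 2 * (h (+ d) + h (+ (2 ℕ.+ d)))
        ≡⟨ sym (fold-spine (pathAdj h) d≤k) ⟩
      fold (pathAdj h) (2 ℕ.+ d)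
        ∎
      where
      factor : ∀ x y → + 2 * x + + 2 * y ≡ + 2 * (y + x)
      factor = solve-∀

    rightLeaf-neighbours : ∀ {d} → k < d → d ≤ 2 ℕ.+ k →
                           upSum F (2 ℕ.+ d) + downSum F (2 ℕ.+ d) ≡ fold (pathAdj h) (2 ℕ.+ d)
    rightLeaf-neighbours {suc e} (s≤s k≤e) (s≤s e≤1+k) = begin
      (δ (suc e) k * (F (3 ℕ.+ k) + F (4 ℕ.+ k)) + spine (suc e) * F (4 ℕ.+ e)) + down
        ≡⟨ cong₂ (λ x y → (x * (F (3 ℕ.+ k) + F (4 ℕ.+ k)) + y * F (4 ℕ.+ e)) + down)
                 (δ-≢ (ℕ.>⇒≢ (s≤s k≤e))) (spine-false (ℕ.m≤n⇒m≤1+n k≤e)) ⟩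
      0ℤ + ((δ e k + δ e (suc k)) * F (2 ℕ.+ k) + spine e * F (2 ℕ.+ e))
        ≡⟨ cong₂ (λ x y → 0ℤ + (x * F (2 ℕ.+ k) + y * F (2 ℕ.+ e)))
                 (rightLeaf-indicator k≤e e≤1+k) (spine-false k≤e) ⟩
      0ℤ + (1ℤ * F (2 ℕ.+ k) + 0ℤ)
        ≡⟨ cong (λ x → 0ℤ + (1ℤ * x + 0ℤ)) (fold-spine h ℕ.≤-refl) ⟩
      0ℤ + (1ℤ * (+ 2 * h (+ suc k)) + 0ℤ)
        ≡⟨ double (h (+ suc k)) ⟩
      1ℤ * (h (+ suc k) + h (+ suc k))
        ≡⟨ cong (λ x → 1ℤ * (h (+ suc k) + x)) (sym (trans (cong h (ℤ.+-comm 1ℤ m)) (evenₘ 1ℤ))) ⟩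
      1ℤ * (h (+ suc k) + h (ℤ.suc m))
        ≡⟨ sym (fold-rightLeaf (pathAdj h) (s≤s k≤e)) ⟩
      fold (pathAdj h) (3 ℕ.+ e)
        ∎
      where
      down = (δ e k + δ e (suc k)) * F (2 ℕ.+ k) + spine e * F (2 ℕ.+ e)
      double : ∀ x → 0ℤ + (1ℤ * (+ 2 * x) + 0ℤ) ≡ 1ℤ * (x + x)
      double = solve-∀

    adjD-fold : ∀ i → (adjD n · (F ∘ toℕ)) i ≡ fold (pathAdj h) (toℕ i)
    adjD-fold i = trans (adjD-row F i) (neighbours (toℕ i) (ℕ.≤-pred (Fin.toℕ<n i)))
      where
      neighbours : ∀ a → a ≤ n → upSum F a + downSum F a ≡ fold (pathAdj h) a
      neighbours 0 _ = leftLeaf-neighbours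
      neighbours 1 _ = leftLeaf-neighbours
      neighbours (suc (suc d)) a≤n with d ℕ.≤? k
      ... | yes d≤k = spine-neighbours d≤k
      ... | no  d≰k = rightLeaf-neighbours (ℕ.≰⇒> d≰k) (ℕ.≤-pred (ℕ.≤-pred a≤n))

  G : ℤ → ℤ
  G y = if does (m ∣? y) then + 2 else 1ℤ

  G-evenAbout : ∀ {c} → m ∣ c → EvenAbout c G
  G-evenAbout m∣c y = cong (λ b → if b then + 2 else 1ℤ) (∣?-evenAbout m∣c y)

  G-multiple : ∀ {y} → m ∣ y → G y ≡ + 2
  G-multiple {y} m∣y = cong (λ b → if b then + 2 else 1ℤ) (dec-true (m ∣? y) m∣y)

  G-between : ∀ {t} → suc t < 2 ℕ.+ k → G (+ suc t) ≡ 1ℤ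
  G-between {t} 1+t<m =
    cong (λ b → if b then + 2 else 1ℤ) (dec-false (m ∣? + suc t) (ℕ.>⇒∤ 1+t<m ∘ ∣⇒∣ᵤ))

  fold-G : ∀ a → a ≤ n → fold G a ≡ + 2
  fold-G 0 _ = cong (1ℤ *_) (G-multiple (divides 0ℤ refl))
  fold-G 1 _ = cong (1ℤ *_) (G-multiple (divides 0ℤ refl))
  fold-G (suc (suc d)) a≤n with d ℕ.≤? k
  ... | yes d≤k = trans (fold-spine G d≤k) (cong (+ 2 *_) (G-between (s≤s (s≤s d≤k))))
  ... | no  d≰k = trans (fold-rightLeaf G (ℕ.≰⇒> d≰k)) (cong (1ℤ *_) (G-multiple ∣-refl))

  walk-fold : ∀ l i → + 2 * powApply (adjD n) l ones i ≡ fold (pathAdj^ l G) (toℕ i)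
  walk-fold zero    i = sym (fold-G (toℕ i) (ℕ.≤-pred (Fin.toℕ<n i)))
  walk-fold (suc l) i = begin
    + 2 * (adjD n · powApply (adjD n) l ones) i
      ≡⟨ ·-*ˡ (adjD n) (powApply (adjD n) l ones) (+ 2) i ⟩
    (adjD n · (λ j → + 2 * powApply (adjD n) l ones j)) i
      ≡⟨ ∑-cong (λ j → cong (adjD n i j *_) (walk-fold l j)) ⟩
    (adjD n · (fold g ∘ toℕ)) i
      ≡⟨ adjD-fold g (pathAdj^-evenAbout 0ℤ G (G-evenAbout (divides 0ℤ refl)) l)
                     (pathAdj^-evenAbout m G (G-evenAbout ∣-refl) l) i ⟩
    fold (pathAdj g) (toℕ i)
      ∎
    where
    g = pathAdj^ l G

  private
    W : Matrix (suc n)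
    W = walkD n

  walk-rows : ∀ i j → (∀ g → fold g (toℕ i) ≡ fold g (toℕ j)) → ∀ l → W i l ≡ W j l
  walk-rows i j same-fold l = ℤ.*-cancelˡ-≡ (+ 2) _ _
    (trans (walk-fold (toℕ l) i) (trans (same-fold (pathAdj^ (toℕ l) G)) (sym (walk-fold (toℕ l) j))))

  walk-annihilated : ∀ c → (∀ y → polyAct (suc n) c G y ≡ 0ℤ) →
                     ∀ i → ∑ (λ l → W i l * c (toℕ l)) ≡ 0ℤ
  walk-annihilated c c≡0 i = ℤ.*-cancelˡ-≡ (+ 2) _ 0ℤ (begin
    + 2 * ∑ {suc n} (λ l → W i l * c (toℕ l))
      ≡⟨ sym (∑-*ˡ {suc n} (+ 2) (λ l → W i l * c (toℕ l))) ⟩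
    ∑ {suc n} (λ l → + 2 * (W i l * c (toℕ l)))
      ≡⟨ ∑-cong {suc n} (λ l → trans (sym (ℤ.*-assoc (+ 2) (W i l) (c (toℕ l))))
                                     (cong (_* c (toℕ l)) (walk-fold (toℕ l) i))) ⟩
    ∑ {suc n} (λ l → foldWeight a * g l * c (toℕ l))
      ≡⟨ ∑-cong {suc n} (λ l → regroup (foldWeight a) (g l) (c (toℕ l))) ⟩
    ∑ {suc n} (λ l → foldWeight a * (c (toℕ l) * g l))
      ≡⟨ ∑-*ˡ {suc n} (foldWeight a) (λ l → c (toℕ l) * g l) ⟩
    foldWeight a * polyAct (suc n) c G (foldPoint a)
      ≡⟨ cong (foldWeight a *_) (c≡0 (foldPoint a)) ⟩
    foldWeight a * 0ℤ
      ≡⟨ ℤ.*-zeroʳ (foldWeight a) ⟩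
    + 2 * 0ℤ
      ∎)
    where
    a = toℕ i
    g : Fin (suc n) → ℤ
    g l = pathAdj^ (toℕ l) G (foldPoint a)
    regroup : ∀ w x c → w * x * c ≡ w * (c * x)
    regroup = solve-∀

  leaf₁ rightLeaf₁ : Fin (suc n)
  leaf₁      = Fin.suc Fin.zero
  rightLeaf₁ = Fin.fromℕ< (ℕ.m<n⇒m<1+n (ℕ.n<1+n (3 ℕ.+ k)))

  toℕ-rightLeaf₁ : toℕ rightLeaf₁ ≡ 3 ℕ.+ k
  toℕ-rightLeaf₁ = Fin.toℕ-fromℕ< (ℕ.m<n⇒m<1+n (ℕ.n<1+n (3 ℕ.+ k)))

  rowOps : Matrix (suc n)
  rowOps i j = δ (toℕ i) 0 * identity leaf₁ j + δ (toℕ i) n * identity rightLeaf₁ j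

  rowOps-⊗ : ∀ (X : Matrix (suc n)) i j →
             (rowOps ⊗ X) i j ≡ δ (toℕ i) 0 * X leaf₁ j + δ (toℕ i) n * X rightLeaf₁ j
  rowOps-⊗ X i j = begin
    ∑ (λ l → (x * identity leaf₁ l + y * identity rightLeaf₁ l) * X l j)
      ≡⟨ ∑-cong (λ l → distrib x (identity leaf₁ l) y (identity rightLeaf₁ l) (X l j)) ⟩
    ∑ (λ l → x * (identity leaf₁ l * X l j) + y * (identity rightLeaf₁ l * X l j))
      ≡⟨ ∑-linear x y (λ l → identity leaf₁ l * X l j) (λ l → identity rightLeaf₁ l * X l j) ⟩
    x * ∑ (λ l → identity leaf₁ l * X l j) + y * ∑ (λ l → identity rightLeaf₁ l * X l j)
      ≡⟨ cong₂ (λ s t → x * s + y * t) (∑-select (λ l → X l j) leaf₁)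
                                        (∑-select (λ l → X l j) rightLeaf₁) ⟩
    x * X leaf₁ j + y * X rightLeaf₁ j
      ∎
    where
    x = δ (toℕ i) 0
    y = δ (toℕ i) n
    distrib : ∀ x a y b z → (x * a + y * b) * z ≡ x * (a * z) + y * (b * z)
    distrib = solve-∀

  rowOps-squareZero : SquareZero rowOps
  rowOps-squareZero i j = begin
    (rowOps ⊗ rowOps) i j
      ≡⟨ rowOps-⊗ rowOps i j ⟩
    δ (toℕ i) 0 * 0ℤ + δ (toℕ i) n * rowOps rightLeaf₁ j
      ≡⟨ cong (λ z → δ (toℕ i) 0 * 0ℤ + δ (toℕ i) n * z) rightLeaf₁-row ⟩
    δ (toℕ i) 0 * 0ℤ + δ (toℕ i) n * 0ℤ
      ≡⟨ vanish (δ (toℕ i) 0) (δ (toℕ i) n) ⟩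
    0ℤ
      ∎
    where
    rightLeaf₁-row : rowOps rightLeaf₁ j ≡ 0ℤ
    rightLeaf₁-row = begin
      rowOps rightLeaf₁ j
        ≡⟨ cong (λ a → δ a 0 * identity leaf₁ j + δ a n * identity rightLeaf₁ j) toℕ-rightLeaf₁ ⟩
      0ℤ + δ (3 ℕ.+ k) n * identity rightLeaf₁ j
        ≡⟨ ℤ.+-identityˡ _ ⟩
      δ (3 ℕ.+ k) n * identity rightLeaf₁ j
        ≡⟨ cong (_* identity rightLeaf₁ j) (δ-≢ (ℕ.<⇒≢ (ℕ.n<1+n (3 ℕ.+ k)))) ⟩
      0ℤ
        ∎
    vanish : ∀ x y → x * 0ℤ + y * 0ℤ ≡ 0ℤ
    vanish = solve-∀

  keepRow : ℕ → ℤ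
  keepRow a = ι ((1 ≤ᵇ a) ∧ (a ≤ᵇ 3 ℕ.+ k))

  rowOps-left : ∀ (X : Matrix (suc n)) →
                (∀ i l → toℕ i ≡ 0 → X i l ≡ X leaf₁ l) →
                (∀ i l → toℕ i ≡ n → X i l ≡ X rightLeaf₁ l) →
                ∀ i l → ((I- rowOps) ⊗ X) i l ≡ keepRow (toℕ i) * X i l
  rowOps-left X leftLeaves rightLeaves i l = begin
    ((I- rowOps) ⊗ X) i l
      ≡⟨ I--⊗ rowOps X i l ⟩
    X i l - (rowOps ⊗ X) i l
      ≡⟨ cong (λ x → X i l - x) (rowOps-⊗ X i l) ⟩
    X i l - (δ (toℕ i) 0 * X leaf₁ l + δ (toℕ i) n * X rightLeaf₁ l)
      ≡⟨ by-row (toℕ i) refl (ℕ.≤-pred (Fin.toℕ<n i)) ⟩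
    keepRow (toℕ i) * X i l
      ∎
    where
    by-row : ∀ a → toℕ i ≡ a → a ≤ n →
             X i l - (δ a 0 * X leaf₁ l + δ a n * X rightLeaf₁ l) ≡ keepRow a * X i l
    by-row zero i≡0 _ = begin
      X i l - (1ℤ * X leaf₁ l + 0ℤ)      ≡⟨ cong (λ x → x - (1ℤ * X leaf₁ l + 0ℤ)) (leftLeaves i l i≡0) ⟩
      X leaf₁ l - (1ℤ * X leaf₁ l + 0ℤ)  ≡⟨ cancel (X leaf₁ l) ⟩
      0ℤ                                 ∎
      where
      cancel : ∀ x → x - (1ℤ * x + 0ℤ) ≡ 0ℤ
      cancel = solve-∀
    by-row (suc b) i≡a a≤n with ℕ.m≤n⇒m<n∨m≡n (ℕ.≤-pred a≤n)
    ... | inj₁ b<3+k = begin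
      X i l - (0ℤ + δ b (3 ℕ.+ k) * X rightLeaf₁ l)
        ≡⟨ cong (λ x → X i l - (0ℤ + x * X rightLeaf₁ l)) (δ-≢ (ℕ.<⇒≢ b<3+k)) ⟩
      X i l - (0ℤ + 0ℤ)
        ≡⟨ ℤ.+-identityʳ (X i l) ⟩
      X i l
        ≡⟨ sym (trans (cong (_* X i l) (ι-true (ℕ.<⇒<ᵇ b<3+k))) (ℤ.*-identityˡ (X i l))) ⟩
      keepRow (suc b) * X i l
        ∎
    ... | inj₂ refl = begin
      X i l - (0ℤ + δ n n * X rightLeaf₁ l)
        ≡⟨ cong₂ (λ x y → x - (0ℤ + y * X rightLeaf₁ l)) (rightLeaves i l i≡a) (δ-refl n) ⟩
      X rightLeaf₁ l - (0ℤ + 1ℤ * X rightLeaf₁ l)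
        ≡⟨ cancel (X rightLeaf₁ l) ⟩
      0ℤ
        ≡⟨ sym (cong (_* X i l) (ι-false (ℕ.<-irrefl refl ∘ ℕ.<ᵇ⇒< (3 ℕ.+ k) (3 ℕ.+ k)))) ⟩
      keepRow n * X i l
        ∎
      where
      cancel : ∀ x → x - (0ℤ + 1ℤ * x) ≡ 0ℤ
      cancel = solve-∀

  private
    q p : ℕ → ℤ
    q = annihilator (suc k)
    p = annihilator⁺ (suc k)

  extraColumn : ℕ → ℕ → ℤ
  extraColumn b = if b ≡ᵇ 3 ℕ.+ k then q else p

  colOps : Matrix (suc n)
  colOps = upperBlock (3 ℕ.+ k) extraColumn

  extraColumn-q : extraColumn (3 ℕ.+ k) ≡ q
  extraColumn-q = cong (λ x → if x then q else p) (true-if-T (ℕ.≡⇒≡ᵇ (3 ℕ.+ k) (3 ℕ.+ k) refl))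

  extraColumn-p : extraColumn n ≡ p
  extraColumn-p = cong (λ x → if x then q else p) (false-if-¬T (ℕ.1+n≢n ∘ ℕ.≡ᵇ⇒≡ n (3 ℕ.+ k)))

  private
    last-two : ∀ {b} → 3 ℕ.+ k ≤ b → b ≤ n → b ≡ 3 ℕ.+ k ⊎ b ≡ n
    last-two 3+k≤b b≤n with ℕ.m≤n⇒m<n∨m≡n b≤n
    ... | inj₁ b<n = inj₁ (ℕ.≤-antisym (ℕ.≤-pred b<n) 3+k≤b)
    ... | inj₂ b≡n = inj₂ b≡n

  extraColumn-tail : ∀ {b c} → 3 ℕ.+ k ≤ b → b ≤ n → 3 ℕ.+ k ≤ c → c ≤ n → extraColumn b c ≡ δ c b
  extraColumn-tail 3+k≤b b≤n 3+k≤c c≤n with last-two 3+k≤b b≤n | last-two 3+k≤c c≤n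
  ... | inj₁ refl | inj₁ refl =
    trans (cong (λ f → f (3 ℕ.+ k)) extraColumn-q) (trans (annihilator-leading (suc k)) (sym (δ-refl (3 ℕ.+ k))))
  ... | inj₁ refl | inj₂ refl =
    trans (cong (λ f → f n) extraColumn-q) (trans (annihilator-vanish (suc k)) (sym (δ-≢ (ℕ.1+n≢n {3 ℕ.+ k}))))
  ... | inj₂ refl | inj₁ refl =
    trans (cong (λ f → f (3 ℕ.+ k)) extraColumn-p)
          (trans (annihilator⁺-vanish (suc k)) (sym (δ-≢ (ℕ.<⇒≢ (ℕ.n<1+n (3 ℕ.+ k))))))
  ... | inj₂ refl | inj₂ refl =
    trans (cong (λ f → f n) extraColumn-p) (trans (annihilator⁺-leading (suc k)) (sym (δ-refl n)))

  colOps-low : ∀ l j → toℕ j < 3 ℕ.+ k → (I+ colOps) l j ≡ identity l j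
  colOps-low l j j<3+k = trans (cong (λ x → identity l j + x) (upperBlock-left (3 ℕ.+ k) extraColumn l j j<3+k))
                               (ℤ.+-identityʳ (identity l j))

  colOps-high : ∀ l j → 3 ℕ.+ k ≤ toℕ j → (I+ colOps) l j ≡ extraColumn (toℕ j) (toℕ l)
  colOps-high l j 3+k≤j with toℕ l ℕ.<? 3 ℕ.+ k
  ... | yes l<3+k = begin
    identity l j + colOps l j
      ≡⟨ cong₂ _+_ (δ-≢ (ℕ.<⇒≢ (ℕ.<-≤-trans l<3+k 3+k≤j)))
                   (upperBlock-entry (3 ℕ.+ k) extraColumn l j l<3+k 3+k≤j) ⟩
    0ℤ + extraColumn (toℕ j) (toℕ l)
      ≡⟨ ℤ.+-identityˡ _ ⟩
    extraColumn (toℕ j) (toℕ l)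
      ∎
  ... | no l≮3+k = begin
    identity l j + colOps l j
      ≡⟨ cong (λ x → identity l j + x) (upperBlock-below (3 ℕ.+ k) extraColumn l j (ℕ.≮⇒≥ l≮3+k)) ⟩
    identity l j + 0ℤ
      ≡⟨ ℤ.+-identityʳ (identity l j) ⟩
    δ (toℕ l) (toℕ j)
      ≡⟨ sym (extraColumn-tail 3+k≤j (bound j) (ℕ.≮⇒≥ l≮3+k) (bound l)) ⟩
    extraColumn (toℕ j) (toℕ l)
      ∎
    where
    bound : ∀ (x : Fin (suc n)) → toℕ x ≤ n
    bound x = ℕ.≤-pred (Fin.toℕ<n x)

  keepCol : ℕ → ℤ
  keepCol b = ι (b ≤ᵇ 2 ℕ.+ k)

  colOps-right : ∀ (X : Matrix (suc n)) → (∀ b i → ∑ (λ l → X i l * extraColumn b (toℕ l)) ≡ 0ℤ) →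
                 ∀ i j → (X ⊗ (I+ colOps)) i j ≡ keepCol (toℕ j) * X i j
  colOps-right X annihilated i j with toℕ j ℕ.<? 3 ℕ.+ k
  ... | yes j<3+k = begin
    ∑ (λ l → X i l * (I+ colOps) l j)  ≡⟨ ∑-cong (λ l → cong (X i l *_) (colOps-low l j j<3+k)) ⟩
    (X ⊗ identity) i j                 ≡⟨ ⊗-identity X i j ⟩
    X i j                              ≡⟨ sym (trans (cong (_* X i j) (ι-true (ℕ.≤⇒≤ᵇ (ℕ.≤-pred j<3+k))))
                                                     (ℤ.*-identityˡ (X i j))) ⟩
    keepCol (toℕ j) * X i j            ∎
  ... | no j≮3+k = begin
    ∑ (λ l → X i l * (I+ colOps) l j)
      ≡⟨ ∑-cong (λ l → cong (X i l *_) (colOps-high l j (ℕ.≮⇒≥ j≮3+k))) ⟩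
    ∑ (λ l → X i l * extraColumn (toℕ j) (toℕ l))
      ≡⟨ annihilated (toℕ j) i ⟩
    0ℤ
      ≡⟨ sym (cong (_* X i j) (ι-false (j≮3+k ∘ s≤s ∘ ℕ.≤ᵇ⇒≤ (toℕ j) (2 ℕ.+ k)))) ⟩
    keepCol (toℕ j) * X i j
      ∎

  walk-leftLeaves : ∀ i l → toℕ i ≡ 0 → W i l ≡ W leaf₁ l
  walk-leftLeaves i l i≡0 = walk-rows i leaf₁ (λ g → cong (fold g) i≡0) l

  walk-rightLeaves : ∀ i l → toℕ i ≡ n → W i l ≡ W rightLeaf₁ l
  walk-rightLeaves i l i≡n = walk-rows i rightLeaf₁ same-fold l
    where
    rightLeaves-fold : ∀ g → fold g (3 ℕ.+ k) ≡ fold g (4 ℕ.+ k)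
    rightLeaves-fold g = trans (fold-rightLeaf g (ℕ.n<1+n k)) (sym (fold-rightLeaf g (ℕ.m<n⇒m<1+n (ℕ.n<1+n k))))
    same-fold : ∀ g → fold g (toℕ i) ≡ fold g (toℕ rightLeaf₁)
    same-fold g = trans (cong (fold g) i≡n) (sym (trans (cong (fold g) toℕ-rightLeaf₁) (rightLeaves-fold g)))

  walk-extraColumns : ∀ b i → ∑ (λ l → W i l * extraColumn b (toℕ l)) ≡ 0ℤ
  walk-extraColumns b = walk-annihilated (extraColumn b) (by-choice (b ≡ᵇ 3 ℕ.+ k))
    where
    even₀ = G-evenAbout (divides 0ℤ refl)
    evenₘ = G-evenAbout ∣-refl
    by-choice : ∀ x y → polyAct (suc n) (if x then q else p) G y ≡ 0ℤ
    by-choice true  = polyAct-annihilator (suc k) G even₀ evenₘ (suc n) (ℕ.m<n⇒m<1+n (ℕ.n<1+n (3 ℕ.+ k)))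
    by-choice false = polyAct-annihilator⁺ (suc k) G even₀ evenₘ (suc n) (ℕ.n<1+n n)

  walkD′-entry : ∀ i j → walkD' n i j ≡ keepRow (toℕ i) * (keepCol (toℕ j) * W i j)
  walkD′-entry i j = begin
    (if lower ∧ (upper ∧ left) then W i j else 0ℤ)
      ≡⟨ if-ι (lower ∧ (upper ∧ left)) (W i j) ⟩
    ι (lower ∧ (upper ∧ left)) * W i j
      ≡⟨ cong (λ x → ι x * W i j) (sym (∧-assoc lower upper left)) ⟩
    ι ((lower ∧ upper) ∧ left) * W i j
      ≡⟨ cong (_* W i j) (ι-∧ (lower ∧ upper) left) ⟩
    keepRow (toℕ i) * keepCol (toℕ j) * W i j
      ≡⟨ ℤ.*-assoc (keepRow (toℕ i)) (keepCol (toℕ j)) (W i j) ⟩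
    keepRow (toℕ i) * (keepCol (toℕ j) * W i j)
      ∎
    where
    lower = 1 ≤ᵇ toℕ i
    upper = toℕ i ≤ᵇ 3 ℕ.+ k
    left  = toℕ j ≤ᵇ 2 ℕ.+ k

  walkD-reduced : (((I- rowOps) ⊗ W) ⊗ (I+ colOps)) ≋ walkD' n
  walkD-reduced i j = begin
    (((I- rowOps) ⊗ W) ⊗ (I+ colOps)) i j
      ≡⟨ ⊗-congˡ-scaled {B = W} (keepRow ∘ toℕ) (I+ colOps)
                        (rowOps-left W walk-leftLeaves walk-rightLeaves) i j ⟩
    keepRow (toℕ i) * (W ⊗ (I+ colOps)) i j
      ≡⟨ cong (keepRow (toℕ i) *_) (colOps-right W walk-extraColumns i j) ⟩
    keepRow (toℕ i) * (keepCol (toℕ j) * W i j)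
      ≡⟨ sym (walkD′-entry i j) ⟩
    walkD' n i j
      ∎

  walkD-equivalent : IntegrallyEquivalent (walkD n) (walkD' n)
  walkD-equivalent =
    I- rowOps , I+ colOps ,
    I--unimodular rowOps rowOps-squareZero ,
    I+-unimodular colOps (upperBlock-squareZero (3 ℕ.+ k) extraColumn) ,
    walkD-reduced

proposition2p8 : (n : ℕ) → 4 ≤ n → IntegrallyEquivalent (walkD n) (walkD' n)
proposition2p8 0 ()
proposition2p8 1 (s≤s ())
proposition2p8 2 (s≤s (s≤s ()))
proposition2p8 3 (s≤s (s≤s (s≤s ())))
proposition2p8 (suc (suc (suc (suc k)))) _ = walkD-equivalent k
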